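{- (i) The product $\ast$ and the coproduct $\delta$ make $\mathcal T$ a $\mathcal P$-graded bialgebra: for all $x,y\in\mathcal T$, $\delta(x\ast y)=\delta(x)\ast_2\delta(y)$. (ii) The product $\circ$ and the coproduct $\delta$ make $\mathcal T$ a bialgebra: for all $x,y\in\mathcal T$, $\delta(x\circ y)=\delta(x)\circ_2\delta(y)$, where $(a\otimes b)\circ_2(c\otimes d)=(a\circ c)\otimes(b\circ d)$.
   Context: Let $\mathbf k$ be a field and $\mathcal P$ the set of finite subsets of the positive integers. $\mathcal T$ is the $\mathbf k$-vector space with basis the symbols $1_{(S_1,\dots,S_k)}$, $k\ge 0$, with $S_1,\dots,S_k\in\mathcal P$ nonempty and pairwise disjoint ($1_\emptyset$ for the empty sequence); a symbol containing empty sets means the same symbol with empty entries deleted. It is $\mathcal P$-graded: $1_{(S_1,\dots,S_k)}$ has degree $S_1\cup\cdots\cup S_k$. Products on basis elements: $1_{(S_1,\dots,S_n)}\ast 1_{(T_1,\dots,T_k)}=1_{(S_1,\dots,S_n,T_1,\dots,T_k)}$ if $(\bigcup S_i)\cap(\bigcup T_j)=\emptyset$ and $0$ otherwise; $1_{(S_1,\dots,S_n)}\circ 1_{(T_1,\dots,T_k)}=0$ if $\bigcup S_i\neq\bigcup T_j$, and otherwise $=1_{(S_1\cap T_1,\dots,S_1\cap T_k,\dots,S_n\cap T_1,\dots,S_n\cap T_k)}$. Coproduct: $\delta(1_{(S_1,\dots,S_k)})=\sum_{T_i\sqcup U_i=S_i}1_{(T_1,\dots,T_k)}\otimes 1_{(U_1,\dots,U_k)}$.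 The $\mathcal P$-graded tensor square is $(\mathcal T\otimes\mathcal T)_X=\bigoplus_{A\sqcup B=X}\mathcal T_A\otimes\mathcal T_B$ (it contains the image of $\delta$), with product: for homogeneous $a\in\mathcal T_A,b\in\mathcal T_B,c\in\mathcal T_C,d\in\mathcal T_D$ ($A\cap B=C\cap D=\emptyset$), $(a\otimes b)\ast_2(c\otimes d)=(a\ast c)\otimes(b\ast d)$ if $(A\cup B)\cap(C\cup D)=\emptyset$ and $0$ otherwise. -}

module Defs where

open import Level using (Level; _⊔_) renaming (suc to lsuc)
open import Algebra.Bundles using (CommutativeRing)
open import Data.Bool using (Bool; true; false; _∧_; _∨_; not; if_then_else_; T)
open import Data.Bool.Properties using (T?)
open import Data.Nat using (ℕ; zero; suc; _≡ᵇ_; _<ᵇ_)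
open import Data.Nat.Properties using () renaming (_≟_ to _≟ℕ_)
open import Data.List using (List; []; _∷_; _++_; map; concat; concatMap; filter; null)
open import Data.List.Properties using (≡-dec)
open import Data.Maybe using (Maybe; just; nothing)
open import Data.Product using (Σ; _×_; _,_; proj₁; proj₂)
open import Relation.Nullary using (¬_; does; yes; no)

record Field (c ℓ : Level) : Set (lsuc (c ⊔ ℓ)) where
  field
    commRing : CommutativeRing c ℓ
  open CommutativeRing commRing public
  field
    1≉0     : ¬ (1# ≈ 0#)
    inverse : ∀ x → ¬ (x ≈ 0#) → Σ Carrier (λ y → (x * y) ≈ 1#)

-- Finite subsets of the positive integers, canonically encoded as
-- strictly increasing lists of positive naturals.  A (raw) word is a
-- list of such sets, i.e. the symbol (S₁,…,S_k).

FinSet : Set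
FinSet = List ℕ

Word : Set
Word = List FinSet

all : {A : Set} → (A → Bool) → List A → Bool
all p []       = true
all p (x ∷ xs) = p x ∧ all p xs

any : {A : Set} → (A → Bool) → List A → Bool
any p []       = false
any p (x ∷ xs) = p x ∨ any p xs

_∈ᵇ_ : ℕ → FinSet → Bool
n ∈ᵇ s = any (λ m → n ≡ᵇ m) s

increasing : FinSet → Bool
increasing []           = true
increasing (x ∷ [])     = true
increasing (x ∷ y ∷ xs) = (x <ᵇ y) ∧ increasing (y ∷ xs)

isCanonicalSet : FinSet → Bool
isCanonicalSet s = all (λ n → 0 <ᵇ n) s ∧ increasing s

disjointᵇ : FinSet → FinSet → Bool
disjointᵇ s t = not (any (λ n → n ∈ᵇ t) s)

pairwiseDisjoint : Word → Bool
pairwiseDisjoint []       = true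
pairwiseDisjoint (s ∷ ss) = all (disjointᵇ s) ss ∧ pairwiseDisjoint ss

valid : Word → Bool
valid w = all (λ s → isCanonicalSet s ∧ not (null s)) w ∧ pairwiseDisjoint w

Basis : Set
Basis = Σ Word (λ w → T (valid w))

deg : Word → FinSet
deg = concat

-- delete empty entries (a symbol with empty entries denotes the symbol
-- with those entries deleted)
dropEmpty : Word → Word
dropEmpty = filter (λ s → T? (not (null s)))

sameSet : FinSet → FinSet → Bool
sameSet s t = all (λ n → n ∈ᵇ t) s ∧ all (λ n → n ∈ᵇ s) t

inter : FinSet → FinSet → FinSet
inter s t = filter (λ n → T? (n ∈ᵇ t)) s

mulW : Word → Word → Maybe Word
mulW s t = if disjointᵇ (deg s) (deg t) then just (s ++ t) else nothing

compW : Word → Word → Maybe Word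
compW s t =
  if sameSet (deg s) (deg t)
  then just (dropEmpty (concatMap (λ a → map (inter a) t) s))
  else nothing

splits : FinSet → List (FinSet × FinSet)
splits []       = ([] , []) ∷ []
splits (x ∷ xs) =
  concatMap (λ p → ((x ∷ proj₁ p) , proj₂ p) ∷ (proj₁ p , (x ∷ proj₂ p)) ∷ []) (splits xs)

splitsW : Word → List (Word × Word)
splitsW []       = ([] , []) ∷ []
splitsW (s ∷ ss) =
  concatMap (λ p → map (λ q → (proj₁ p ∷ proj₁ q) , (proj₂ p ∷ proj₂ q)) (splitsW ss)) (splits s)

deltaW : Word → List (Word × Word)
deltaW w = map (λ p → dropEmpty (proj₁ p) , dropEmpty (proj₂ p)) (splitsW w)

-- The vector spaces 𝒯 and 𝒯 ⊗ 𝒯 over a field, as finite formal linear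
-- combinations of basis symbols, with equality = equality of all
-- coefficients.

module Tensor {c ℓ : Level} (k : Field c ℓ) where
  open Field k

  eqW : Word → Word → Bool
  eqW v w = does (≡-dec (≡-dec _≟ℕ_) v w)

  𝒯 : Set c
  𝒯 = List (Carrier × Basis)

  𝒯⊗𝒯 : Set c
  𝒯⊗𝒯 = List (Carrier × Basis × Basis)

  coeff : 𝒯 → Basis → Carrier
  coeff []              b = 0#
  coeff ((a , v) ∷ xs) b =
    (if eqW (proj₁ v) (proj₁ b) then a else 0#) + coeff xs b

  coeff₂ : 𝒯⊗𝒯 → Basis → Basis → Carrier
  coeff₂ []                   b₁ b₂ = 0#
  coeff₂ ((a , v₁ , v₂) ∷ xs) b₁ b₂ =
    (if eqW (proj₁ v₁) (proj₁ b₁) ∧ eqW (proj₁ v₂) (proj₁ b₂) then a else 0#)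
    + coeff₂ xs b₁ b₂

  infix 4 _≋_ _≋₂_
  _≋_ : 𝒯 → 𝒯 → Set ℓ
  x ≋ y = ∀ b → coeff x b ≈ coeff y b

  _≋₂_ : 𝒯⊗𝒯 → 𝒯⊗𝒯 → Set ℓ
  x ≋₂ y = ∀ b₁ b₂ → coeff₂ x b₁ b₂ ≈ coeff₂ y b₁ b₂

  -- a raw word as a basis vector (only ever applied to valid words;
  -- an invalid word would give 0)
  toBasis : Word → List Basis
  toBasis w with T? (valid w)
  ... | yes p = (w , p) ∷ []
  ... | no  _ = []

  embed : Carrier → Maybe Word → 𝒯
  embed a (just w) = map (λ b → a , b) (toBasis w)
  embed a nothing  = []

  embed₂ : Carrier → Maybe Word → Maybe Word → 𝒯⊗𝒯
  embed₂ a (just w₁) (just w₂) =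
    concatMap (λ b₁ → map (λ b₂ → a , b₁ , b₂) (toBasis w₂)) (toBasis w₁)
  embed₂ a _ _ = []

  bilin : (Word → Word → Maybe Word) → 𝒯 → 𝒯 → 𝒯
  bilin op x y =
    concatMap (λ p → concatMap (λ q →
      embed (proj₁ p * proj₁ q) (op (proj₁ (proj₂ p)) (proj₁ (proj₂ q)))) y) x

  _∗_ : 𝒯 → 𝒯 → 𝒯
  _∗_ = bilin mulW

  _∘_ : 𝒯 → 𝒯 → 𝒯
  _∘_ = bilin compW

  δ : 𝒯 → 𝒯⊗𝒯
  δ x = concatMap (λ p → concatMap (λ q → embed₂ (proj₁ p) (just (proj₁ q)) (just (proj₂ q)))
                                   (deltaW (proj₁ (proj₂ p)))) x

  mul₂W : Word → Word → Word → Word → Maybe Word × Maybe Word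
  mul₂W a b c d =
    if disjointᵇ (deg a ++ deg b) (deg c ++ deg d)
    then (mulW a c , mulW b d)
    else (nothing , nothing)

  comp₂W : Word → Word → Word → Word → Maybe Word × Maybe Word
  comp₂W a b c d = (compW a c , compW b d)

  bilin₂ : (Word → Word → Word → Word → Maybe Word × Maybe Word) → 𝒯⊗𝒯 → 𝒯⊗𝒯 → 𝒯⊗𝒯
  bilin₂ op x y =
    concatMap (λ p → concatMap (λ q →
      let r = op (proj₁ (proj₁ (proj₂ p))) (proj₁ (proj₂ (proj₂ p)))
                 (proj₁ (proj₁ (proj₂ q))) (proj₁ (proj₂ (proj₂ q)))
      in embed₂ (proj₁ p * proj₁ q) (proj₁ r) (proj₂ r)) y) x

  _∗₂_ : 𝒯⊗𝒯 → 𝒯⊗𝒯 → 𝒯⊗𝒯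
  _∗₂_ = bilin₂ mul₂W

  _∘₂_ : 𝒯⊗𝒯 → 𝒯⊗𝒯 → 𝒯⊗𝒯
  _∘₂_ = bilin₂ comp₂W

{-# OPTIONS --safe #-}
-- Both identities are bilinear, so it suffices to compare the coefficients of every basis tensor
-- b₁ ⊗ b₂ on two basis symbols 1_s and 1_t.  A subset C of the degree of w gives the splitting
-- w|C ⊗ w|∁C (intersect every entry with C, resp. with its complement, and delete empty entries),
-- and δ(1_w) is the sum of these splittings over all C ⊆ deg w.  For ∗, the subsets of
-- deg s ⊔ deg t are the unions C ⊔ D, and restriction distributes over concatenation.  For ∘,
-- restriction commutes with composition, and the (C, D) term of δ(1_s) ∘₂ δ(1_t) vanishes unless
-- C and D agree on deg s = deg t, so the double sum collapses to its diagonal; this is δ(1_{s ∘ t})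
-- summed over the subsets of deg s instead of those of deg (s ∘ t), which is the same set.
module Submission where

open import Defs
open import Level using (Level; _⊔_)
open import Algebra.Bundles using (CommutativeMonoid)
open import Data.Bool using (Bool; true; false; _∧_; _∨_; not; if_then_else_; T)
open import Data.Bool.Properties using (T?; T-≡; ¬-not; ∨-zeroʳ; ∧-assoc; ∧-idem; ∧-comm) renaming (_≟_ to _≟ᵇ_)
open import Data.Empty using (⊥; ⊥-elim)
open import Data.Nat using (ℕ; _<_; _<ᵇ_; _≡ᵇ_)
open import Data.Nat.Properties using (_≟_; <-trans; <⇒≢; <ᵇ⇒<; <⇒<ᵇ)
open import Data.Product using (_×_; _,_; proj₁; proj₂; ∃-syntax)
open import Data.Sum using (_⊎_; inj₁; inj₂; [_,_]′)
open import Data.List using (List; []; _∷_; _++_; map; concatMap; filter; null)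
open import Data.Maybe using (Maybe; just; nothing)
open import Data.List.Properties using (≡-dec; concat-++; filter-++; map-++; map-cong; map-∘; map-concatMap; concatMap-cong; concatMap-map)
open import Data.List.Relation.Unary.Any using (Any; here; there)
open import Data.List.Relation.Unary.All using (All; []; _∷_)
import Data.List.Relation.Unary.All as All
import Data.List.Relation.Unary.All.Properties as All
open import Data.List.Relation.Unary.AllPairs using (AllPairs; []; _∷_)
import Data.List.Relation.Unary.AllPairs as AllPairs
import Data.List.Relation.Unary.AllPairs.Properties as AllPairs
open import Data.List.Relation.Unary.Linked using (Linked; []; [-]; _∷_)
import Data.List.Relation.Unary.Linked.Properties as Linked
open import Data.List.Relation.Unary.Unique.Propositional using (Unique)
import Data.List.Relation.Unary.Unique.Propositional.Properties as Unique
open import Data.List.Membership.Propositional using (_∈_; _∉_; find; lose)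
open import Data.List.Membership.Propositional.Properties
  using (∈-filter⁺; ∈-filter⁻; ∈-++⁺ˡ; ∈-++⁺ʳ; ∈-++⁻; ∈-map⁺; ∈-map⁻; ∈-concat⁺′; ∈-concat⁻′)
open import Data.List.Relation.Binary.Subset.Propositional using (_⊆_)
open import Data.List.Relation.Binary.Disjoint.Propositional using (Disjoint)
open import Function using (_∘′_; Equivalence)
open import Relation.Nullary using (Dec; yes; no; does; ¬_)
open import Relation.Nullary.Decidable using (dec-true; dec-false)
open import Relation.Binary.PropositionalEquality using (_≡_; _≢_; refl; sym; trans; cong; cong₂; subst; module ≡-Reasoning)

private
  variable
    A : Set

does⇒ : {P : Set} (d : Dec P) → does d ≡ true → P
does⇒ (yes p) _ = p

∧-true⁻ : ∀ {a b} → a ∧ b ≡ true → a ≡ true × b ≡ true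
∧-true⁻ {true} {true} _ = refl , refl

∧-true⁺ : ∀ {a b} → a ≡ true → b ≡ true → a ∧ b ≡ true
∧-true⁺ refl refl = refl

≡true-ext : ∀ {a b} → (a ≡ true → b ≡ true) → (b ≡ true → a ≡ true) → a ≡ b
≡true-ext {true}  {true}  _ _ = refl
≡true-ext {true}  {false} f _ = sym (f refl)
≡true-ext {false} {true}  _ g = g refl
≡true-ext {false} {false} _ _ = refl

false≢true : false ≢ true
false≢true ()

module _ {P : A → Set} (p : A → Bool) where

  any⇒Any : (∀ x → p x ≡ true → P x) → ∀ xs → any p xs ≡ true → Any P xs
  any⇒Any sound (x ∷ xs) e with p x in px
  ... | true  = here (sound x px)
  ... | false = there (any⇒Any sound xs e)

  Any⇒any : (∀ {x} → P x → p x ≡ true) → ∀ {xs} → Any P xs → any p xs ≡ true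
  Any⇒any complete (here px) rewrite complete px = refl
  Any⇒any complete {x ∷ _} (there pxs) rewrite Any⇒any complete pxs = ∨-zeroʳ (p x)

  all⇒All : (∀ x → p x ≡ true → P x) → ∀ xs → all p xs ≡ true → All P xs
  all⇒All sound []       _ = []
  all⇒All sound (x ∷ xs) e =
    sound x (proj₁ (∧-true⁻ e)) ∷ all⇒All sound xs (proj₂ (∧-true⁻ {p x} e))

  All⇒all : (∀ {x} → P x → p x ≡ true) → ∀ {xs} → All P xs → all p xs ≡ true
  All⇒all complete []         = refl
  All⇒all complete (px ∷ pxs) = ∧-true⁺ (complete px) (All⇒all complete pxs)

all-cong : ∀ (p q : A → Bool) xs → (∀ {x} → x ∈ xs → p x ≡ q x) → all p xs ≡ all q xs
all-cong p q []       _   = refl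
all-cong p q (x ∷ xs) p≗q = cong₂ _∧_ (p≗q (here refl)) (all-cong p q xs (p≗q ∘′ there))

_∋ᵇ_ : FinSet → ℕ → Bool
C ∋ᵇ n = n ∈ᵇ C

∈ᵇ⇒∈ : ∀ xs n → n ∈ᵇ xs ≡ true → n ∈ xs
∈ᵇ⇒∈ xs n = any⇒Any (λ m → n ≡ᵇ m) (λ m → does⇒ (n ≟ m)) xs

∈⇒∈ᵇ : ∀ {n xs} → n ∈ xs → n ∈ᵇ xs ≡ true
∈⇒∈ᵇ {n} = Any⇒any (λ m → n ≡ᵇ m) (dec-true (n ≟ _))

∉⇒∈ᵇ≡false : ∀ {n} xs → n ∉ xs → n ∈ᵇ xs ≡ false
∉⇒∈ᵇ≡false xs n∉xs = ¬-not (n∉xs ∘′ ∈ᵇ⇒∈ xs _)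

∋ᵇ-head : ∀ x C → (x ∷ C) ∋ᵇ x ≡ true
∋ᵇ-head x C = ∈⇒∈ᵇ {x} {x ∷ C} (here refl)

∋ᵇ-tail : ∀ x C {n} → n ≢ x → (x ∷ C) ∋ᵇ n ≡ C ∋ᵇ n
∋ᵇ-tail x C {n} n≢x = cong (_∨ C ∋ᵇ n) (dec-false (n ≟ x) n≢x)

∋ᵇ-++ˡ : ∀ C D {n} → n ∉ D → (C ++ D) ∋ᵇ n ≡ C ∋ᵇ n
∋ᵇ-++ˡ C D {n} n∉D = ≡true-ext
  (λ e → ∈⇒∈ᵇ {n} ([ (λ n∈C → n∈C) , (λ n∈D → ⊥-elim (n∉D n∈D)) ]′ (∈-++⁻ C (∈ᵇ⇒∈ (C ++ D) _ e))))
  (λ e → ∈⇒∈ᵇ {n} (∈-++⁺ˡ (∈ᵇ⇒∈ C _ e)))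

∋ᵇ-++ʳ : ∀ C D {n} → n ∉ C → (C ++ D) ∋ᵇ n ≡ D ∋ᵇ n
∋ᵇ-++ʳ C D {n} n∉C = ≡true-ext
  (λ e → ∈⇒∈ᵇ {n} ([ (λ n∈C → ⊥-elim (n∉C n∈C)) , (λ n∈D → n∈D) ]′ (∈-++⁻ C (∈ᵇ⇒∈ (C ++ D) _ e))))
  (λ e → ∈⇒∈ᵇ {n} (∈-++⁺ʳ C (∈ᵇ⇒∈ D _ e)))

disjointᵇ⇒Disjoint : ∀ u v → disjointᵇ u v ≡ true → Disjoint u v
disjointᵇ⇒Disjoint u v e (n∈u , n∈v) = false≢true (trans (sym (cong not hit)) e)
  where
  hit : any (λ m → m ∈ᵇ v) u ≡ true
  hit = Any⇒any {P = _∈ v} (λ m → m ∈ᵇ v) ∈⇒∈ᵇ (lose n∈u n∈v)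

Disjoint⇒disjointᵇ : ∀ u v → Disjoint u v → disjointᵇ u v ≡ true
Disjoint⇒disjointᵇ u v u#v with any (λ m → m ∈ᵇ v) u in hit
... | true  = ⊥-elim (u#v (proj₂ (find (any⇒Any (λ m → m ∈ᵇ v) (∈ᵇ⇒∈ v) u hit))))
... | false = refl

sameSet⇒⊆⊇ : ∀ u v → sameSet u v ≡ true → u ⊆ v × v ⊆ u
sameSet⇒⊆⊇ u v e =
  All.lookup (all⇒All (λ m → m ∈ᵇ v) (∈ᵇ⇒∈ v) u (proj₁ (∧-true⁻ e))) ,
  All.lookup (all⇒All (λ m → m ∈ᵇ u) (∈ᵇ⇒∈ u) v (proj₂ (∧-true⁻ {all (λ m → m ∈ᵇ v) u} e)))

⊆⊇⇒sameSet : ∀ u v → u ⊆ v → v ⊆ u → sameSet u v ≡ true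
⊆⊇⇒sameSet u v u⊆v v⊆u =
  ∧-true⁺ (All⇒all (λ m → m ∈ᵇ v) ∈⇒∈ᵇ (All.tabulate u⊆v))
          (All⇒all (λ m → m ∈ᵇ u) ∈⇒∈ᵇ (All.tabulate v⊆u))

-- Filtering and restriction of words

keep : (A → Bool) → List A → List A
keep p = filter (λ x → T? (p x))

∈-keep⁻ : ∀ (p : A → Bool) {xs x} → x ∈ keep p xs → x ∈ xs × p x ≡ true
∈-keep⁻ p x∈ = let x∈xs , px = ∈-filter⁻ (λ x → T? (p x)) x∈ in x∈xs , Equivalence.to T-≡ px

∈-keep⁺ : ∀ (p : A → Bool) {xs x} → x ∈ xs → p x ≡ true → x ∈ keep p xs
∈-keep⁺ p x∈xs px = ∈-filter⁺ (λ x → T? (p x)) x∈xs (Equivalence.from T-≡ px)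

keep-cong : ∀ (p q : A → Bool) xs → (∀ {x} → x ∈ xs → p x ≡ q x) → keep p xs ≡ keep q xs
keep-cong p q []       _   = refl
keep-cong p q (x ∷ xs) p≗q rewrite p≗q (here refl) with q x
... | true  = cong (x ∷_) (keep-cong p q xs (p≗q ∘′ there))
... | false = keep-cong p q xs (p≗q ∘′ there)

keep-accept : ∀ (p : A → Bool) x xs → p x ≡ true → keep p (x ∷ xs) ≡ x ∷ keep p xs
keep-accept p x xs px rewrite px = refl

keep-reject : ∀ (p : A → Bool) x xs → p x ≡ false → keep p (x ∷ xs) ≡ keep p xs
keep-reject p x xs px rewrite px = refl

keep-keep : ∀ (p q : A → Bool) xs → keep q (keep p xs) ≡ keep (λ x → p x ∧ q x) xs
keep-keep p q []       = refl
keep-keep p q (x ∷ xs) with p x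
... | false = keep-keep p q xs
... | true with q x
...   | true  = cong (x ∷_) (keep-keep p q xs)
...   | false = keep-keep p q xs

keep-++ : ∀ (p : A → Bool) xs ys → keep p (xs ++ ys) ≡ keep p xs ++ keep p ys
keep-++ p = filter-++ (λ x → T? (p x))

keep-concatMap : ∀ {B : Set} (p : A → Bool) (f : B → List A) xs →
                 keep p (concatMap f xs) ≡ concatMap (keep p ∘′ f) xs
keep-concatMap p f []       = refl
keep-concatMap p f (x ∷ xs) =
  trans (keep-++ p (f x) (concatMap f xs)) (cong (keep p (f x) ++_) (keep-concatMap p f xs))

keep-none : ∀ (xs : List A) → keep (λ _ → false) xs ≡ []
keep-none []       = refl
keep-none (x ∷ xs) = keep-none xs

∈ᵇ-keep : ∀ p xs n → n ∈ᵇ keep p xs ≡ (p n ∧ n ∈ᵇ xs)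
∈ᵇ-keep p xs n = ≡true-ext
  (λ e → let n∈xs , pn = ∈-keep⁻ p {xs} (∈ᵇ⇒∈ (keep p xs) n e) in ∧-true⁺ pn (∈⇒∈ᵇ n∈xs))
  (λ e → let pn , n∈ᵇxs = ∧-true⁻ {p n} e in ∈⇒∈ᵇ (∈-keep⁺ p (∈ᵇ⇒∈ xs n n∈ᵇxs) pn))

inter-keep : ∀ p a b → inter (keep p a) (keep p b) ≡ keep p (inter a b)
inter-keep p a b = begin
  keep (λ n → n ∈ᵇ keep p b) (keep p a)      ≡⟨ keep-keep p _ a ⟩
  keep (λ n → p n ∧ n ∈ᵇ keep p b) a         ≡⟨ keep-cong _ _ a (λ {n} _ → p∧[p∧q]≡q∧p n) ⟩
  keep (λ n → n ∈ᵇ b ∧ p n) a                ≡⟨ keep-keep (b ∋ᵇ_) p a ⟨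
  keep p (keep (b ∋ᵇ_) a)                    ∎
  where
  open ≡-Reasoning
  p∧[p∧q]≡q∧p : ∀ n → p n ∧ n ∈ᵇ keep p b ≡ n ∈ᵇ b ∧ p n
  p∧[p∧q]≡q∧p n = begin
    p n ∧ n ∈ᵇ keep p b      ≡⟨ cong (p n ∧_) (∈ᵇ-keep p b n) ⟩
    p n ∧ (p n ∧ n ∈ᵇ b)     ≡⟨ ∧-assoc (p n) (p n) (n ∈ᵇ b) ⟨
    (p n ∧ p n) ∧ n ∈ᵇ b     ≡⟨ cong (_∧ n ∈ᵇ b) (∧-idem (p n)) ⟩
    p n ∧ n ∈ᵇ b             ≡⟨ ∧-comm (p n) (n ∈ᵇ b) ⟩
    n ∈ᵇ b ∧ p n             ∎

nonEmpty : FinSet → Bool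
nonEmpty s = not (null s)

deg-dropEmpty : ∀ w → deg (dropEmpty w) ≡ deg w
deg-dropEmpty []            = refl
deg-dropEmpty ([] ∷ w)      = deg-dropEmpty w
deg-dropEmpty ((x ∷ s) ∷ w) = cong ((x ∷ s) ++_) (deg-dropEmpty w)

dropEmpty-map-dropEmpty : ∀ (f : FinSet → FinSet) → f [] ≡ [] → ∀ w →
                          dropEmpty (map f (dropEmpty w)) ≡ dropEmpty (map f w)
dropEmpty-map-dropEmpty f f[]≡[] []            = refl
dropEmpty-map-dropEmpty f f[]≡[] ([] ∷ w)      rewrite f[]≡[] = dropEmpty-map-dropEmpty f f[]≡[] w
dropEmpty-map-dropEmpty f f[]≡[] ((x ∷ s) ∷ w) with nonEmpty (f (x ∷ s))
... | true  = cong (f (x ∷ s) ∷_) (dropEmpty-map-dropEmpty f f[]≡[] w)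
... | false = dropEmpty-map-dropEmpty f f[]≡[] w

concatMap-dropEmpty : ∀ (f : FinSet → Word) → f [] ≡ [] → ∀ w →
                      concatMap f (dropEmpty w) ≡ concatMap f w
concatMap-dropEmpty f f[]≡[] []            = refl
concatMap-dropEmpty f f[]≡[] ([] ∷ w)      rewrite f[]≡[] = concatMap-dropEmpty f f[]≡[] w
concatMap-dropEmpty f f[]≡[] ((x ∷ s) ∷ w) = cong (f (x ∷ s) ++_) (concatMap-dropEmpty f f[]≡[] w)

dropEmpty-map-inter[] : ∀ w → dropEmpty (map (inter []) w) ≡ []
dropEmpty-map-inter[] []      = refl
dropEmpty-map-inter[] (_ ∷ w) = dropEmpty-map-inter[] w

restrict : (ℕ → Bool) → Word → Word
restrict p w = dropEmpty (map (keep p) w)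

deg-restrict : ∀ p w → deg (restrict p w) ≡ keep p (deg w)
deg-restrict p w = trans (deg-dropEmpty (map (keep p) w)) (deg-map-keep w)
  where
  deg-map-keep : ∀ w → deg (map (keep p) w) ≡ keep p (deg w)
  deg-map-keep []      = refl
  deg-map-keep (s ∷ w) = trans (cong (keep p s ++_) (deg-map-keep w)) (sym (keep-++ p s (deg w)))

∈-deg-restrict⁻ : ∀ p w {n} → n ∈ deg (restrict p w) → n ∈ deg w × p n ≡ true
∈-deg-restrict⁻ p w n∈ = ∈-keep⁻ p {deg w} (subst (_ ∈_) (deg-restrict p w) n∈)

∈-deg-restrict⁺ : ∀ p w {n} → n ∈ deg w → p n ≡ true → n ∈ deg (restrict p w)
∈-deg-restrict⁺ p w n∈w pn = subst (_ ∈_) (sym (deg-restrict p w)) (∈-keep⁺ p n∈w pn)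

map-keep-cong : ∀ p q w → (∀ {n} → n ∈ deg w → p n ≡ q n) → map (keep p) w ≡ map (keep q) w
map-keep-cong p q []      _   = refl
map-keep-cong p q (s ∷ w) p≗q =
  cong₂ _∷_ (keep-cong p q s (p≗q ∘′ ∈-++⁺ˡ)) (map-keep-cong p q w (p≗q ∘′ ∈-++⁺ʳ s))

restrict-cong : ∀ p q w → (∀ {n} → n ∈ deg w → p n ≡ q n) → restrict p w ≡ restrict q w
restrict-cong p q w = cong dropEmpty ∘′ map-keep-cong p q w

restrict-++ : ∀ p s t → restrict p (s ++ t) ≡ restrict p s ++ restrict p t
restrict-++ p s t =
  trans (cong dropEmpty (map-++ (keep p) s t)) (keep-++ nonEmpty (map (keep p) s) (map (keep p) t))

intersections : Word → Word → Word
intersections s t = concatMap (λ a → map (inter a) t) s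

compose : Word → Word → Word
compose s t = dropEmpty (intersections s t)

restrict-compose : ∀ p s t → restrict p (compose s t) ≡ compose (restrict p s) (restrict p t)
restrict-compose p s t = begin
  dropEmpty (map (keep p) (dropEmpty (intersections s t)))
    ≡⟨ dropEmpty-map-dropEmpty (keep p) refl (intersections s t) ⟩
  dropEmpty (map (keep p) (intersections s t))
    ≡⟨ cong dropEmpty (map-concatMap (keep p) _ s) ⟩
  dropEmpty (concatMap (λ a → map (keep p) (map (inter a) t)) s)
    ≡⟨ keep-concatMap nonEmpty _ s ⟩
  concatMap (λ a → dropEmpty (map (keep p) (map (inter a) t))) s
    ≡⟨ concatMap-cong per-entry s ⟩
  concatMap (λ a → dropEmpty (map (inter (keep p a)) t′)) s
    ≡⟨ concatMap-map (λ a → dropEmpty (map (inter a) t′)) (keep p) s ⟨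
  concatMap (λ a → dropEmpty (map (inter a) t′)) (map (keep p) s)
    ≡⟨ concatMap-dropEmpty (λ a → dropEmpty (map (inter a) t′)) (dropEmpty-map-inter[] t′) (map (keep p) s) ⟨
  concatMap (λ a → dropEmpty (map (inter a) t′)) (restrict p s)
    ≡⟨ keep-concatMap nonEmpty (λ a → map (inter a) t′) (restrict p s) ⟨
  compose (restrict p s) t′
    ∎
  where
  open ≡-Reasoning
  t′ = restrict p t
  per-entry : ∀ a → dropEmpty (map (keep p) (map (inter a) t)) ≡ dropEmpty (map (inter (keep p a)) t′)
  per-entry a = begin
    dropEmpty (map (keep p) (map (inter a) t))
      ≡⟨ cong dropEmpty (map-∘ t) ⟨
    dropEmpty (map (keep p ∘′ inter a) t)
      ≡⟨ cong dropEmpty (map-cong (λ b → sym (inter-keep p a b)) t) ⟩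
    dropEmpty (map (inter (keep p a) ∘′ keep p) t)
      ≡⟨ cong dropEmpty (map-∘ t) ⟩
    dropEmpty (map (inter (keep p a)) (map (keep p) t))
      ≡⟨ dropEmpty-map-dropEmpty (inter (keep p a)) (keep-none {A = ℕ} (keep p a)) (map (keep p) t) ⟨
    dropEmpty (map (inter (keep p a)) t′)
      ∎

ValidEntry : FinSet → Set
ValidEntry s = (isCanonicalSet s ∧ nonEmpty s) ≡ true

record Valid (w : Word) : Set where
  field
    entries  : ∀ {s} → s ∈ w → ValidEntry s
    disjoint : AllPairs Disjoint w

T-valid⇒Valid : ∀ {w} → T (valid w) → Valid w
T-valid⇒Valid {w} tv = record
  { entries  = All.lookup (all⇒All _ (λ _ e → e) w (proj₁ (∧-true⁻ v)))
  ; disjoint = pairwiseDisjoint⇒AllPairs w (proj₂ (∧-true⁻ {all _ w} v))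
  }
  where
  v = Equivalence.to T-≡ tv
  pairwiseDisjoint⇒AllPairs : ∀ w → pairwiseDisjoint w ≡ true → AllPairs Disjoint w
  pairwiseDisjoint⇒AllPairs []      _ = []
  pairwiseDisjoint⇒AllPairs (s ∷ w) e =
    all⇒All (disjointᵇ s) (disjointᵇ⇒Disjoint s) w (proj₁ (∧-true⁻ e)) ∷
    pairwiseDisjoint⇒AllPairs w (proj₂ (∧-true⁻ {all (disjointᵇ s) w} e))

Valid⇒T-valid : ∀ {w} → Valid w → T (valid w)
Valid⇒T-valid {w} v = Equivalence.from T-≡
  (∧-true⁺ (All⇒all _ (λ e → e) (All.tabulate (Valid.entries v))) (AllPairs⇒pairwiseDisjoint (Valid.disjoint v)))
  where
  AllPairs⇒pairwiseDisjoint : ∀ {w} → AllPairs Disjoint w → pairwiseDisjoint w ≡ true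
  AllPairs⇒pairwiseDisjoint []                = refl
  AllPairs⇒pairwiseDisjoint {s ∷ _} (d ∷ ds) =
    ∧-true⁺ (All⇒all (disjointᵇ s) (λ {x} → Disjoint⇒disjointᵇ s x) d) (AllPairs⇒pairwiseDisjoint ds)

increasing⇒Linked : ∀ xs → increasing xs ≡ true → Linked _<_ xs
increasing⇒Linked []           _ = []
increasing⇒Linked (x ∷ [])     _ = [-]
increasing⇒Linked (x ∷ y ∷ xs) e =
  <ᵇ⇒< x y (Equivalence.from T-≡ (proj₁ (∧-true⁻ e))) ∷
  increasing⇒Linked (y ∷ xs) (proj₂ (∧-true⁻ {x <ᵇ y} e))

Linked⇒increasing : ∀ {xs} → Linked _<_ xs → increasing xs ≡ true
Linked⇒increasing []          = refl
Linked⇒increasing [-]         = refl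
Linked⇒increasing (x<y ∷ x<s) = ∧-true⁺ (Equivalence.to T-≡ (<⇒<ᵇ x<y)) (Linked⇒increasing x<s)

ValidEntry⇒AllPairs< : ∀ s → ValidEntry s → AllPairs _<_ s
ValidEntry⇒AllPairs< s v =
  Linked.Linked⇒AllPairs <-trans (increasing⇒Linked s (proj₂ (∧-true⁻ {all _ s} (proj₁ (∧-true⁻ v)))))

ValidEntry-keep : ∀ p s → ValidEntry s → nonEmpty (keep p s) ≡ true → ValidEntry (keep p s)
ValidEntry-keep p s v ne = ∧-true⁺ (∧-true⁺ positive sorted) ne
  where
  canonical = proj₁ (∧-true⁻ v)
  positive : all (0 <ᵇ_) (keep p s) ≡ true
  positive = All⇒all _ (λ e → e)
    (All.filter⁺ (λ x → T? (p x)) (all⇒All _ (λ _ e → e) s (proj₁ (∧-true⁻ canonical))))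
  sorted : increasing (keep p s) ≡ true
  sorted = Linked⇒increasing
    (Linked.filter⁺ (λ x → T? (p x)) <-trans (increasing⇒Linked s (proj₂ (∧-true⁻ {all _ s} canonical))))

Unique-head : ∀ {x} {xs : List A} → Unique (x ∷ xs) → x ∉ xs
Unique-head (x≢xs ∷ _) x∈xs = All.lookup x≢xs x∈xs refl

Unique-++⁻ : ∀ (xs : List A) {ys} → Unique (xs ++ ys) → Unique xs × Unique ys × Disjoint xs ys
Unique-++⁻ []       u = [] , u , λ ()
Unique-++⁻ (x ∷ xs) (x≢ ∷ u) with Unique-++⁻ xs u
... | uxs , uys , xs#ys =
  All.tabulate (All.lookup x≢ ∘′ ∈-++⁺ˡ) ∷ uxs , uys ,
  λ { (here refl , n∈ys)  → All.lookup x≢ (∈-++⁺ʳ xs n∈ys) refl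
    ; (there n∈xs , n∈ys) → xs#ys (n∈xs , n∈ys) }

Valid⇒Unique-deg : ∀ {w} → Valid w → Unique (deg w)
Valid⇒Unique-deg v =
  Unique.concat⁺ (All.tabulate (λ {s} s∈w → AllPairs.map <⇒≢ (ValidEntry⇒AllPairs< s (Valid.entries v s∈w))))
                 (Valid.disjoint v)

Disjoint-mono : ∀ {u v u′ v′ : FinSet} → u′ ⊆ u → v′ ⊆ v → Disjoint u v → Disjoint u′ v′
Disjoint-mono u′⊆u v′⊆v u#v (n∈u′ , n∈v′) = u#v (u′⊆u n∈u′ , v′⊆v n∈v′)

Valid-++ : ∀ {s t} → Valid s → Valid t → Disjoint (deg s) (deg t) → Valid (s ++ t)
Valid-++ {s} vs vt s#t = record
  { entries  = [ Valid.entries vs , Valid.entries vt ]′ ∘′ ∈-++⁻ s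
  ; disjoint = AllPairs.++⁺ (Valid.disjoint vs) (Valid.disjoint vt)
      (All.tabulate λ a∈s → All.tabulate λ b∈t →
         Disjoint-mono (λ n∈a → ∈-concat⁺′ n∈a a∈s) (λ n∈b → ∈-concat⁺′ n∈b b∈t) s#t)
  }

Valid-restrict : ∀ p {w} → Valid w → Valid (restrict p w)
Valid-restrict p {w} vw = record
  { entries  = entries
  ; disjoint = AllPairs.filter⁺ (λ s → T? (nonEmpty s)) (AllPairs.map⁺ (AllPairs.map
                 (Disjoint-mono (proj₁ ∘′ ∈-keep⁻ p) (proj₁ ∘′ ∈-keep⁻ p)) (Valid.disjoint vw)))
  }
  where
  entries : ∀ {s} → s ∈ restrict p w → ValidEntry s
  entries s∈ with ∈-keep⁻ nonEmpty s∈
  ... | s∈′ , ne with ∈-map⁻ (keep p) s∈′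
  ...   | s₀ , s₀∈w , refl = ValidEntry-keep p s₀ (Valid.entries vw s₀∈w) ne

∈-intersections⁻ : ∀ s t {u} → u ∈ intersections s t → ∃[ a ] ∃[ b ] a ∈ s × b ∈ t × u ≡ inter a b
∈-intersections⁻ s t u∈ with ∈-concat⁻′ (map (λ a → map (inter a) t) s) u∈
... | _ , u∈row , row∈ with ∈-map⁻ (λ a → map (inter a) t) row∈
...   | a , a∈s , refl with ∈-map⁻ (inter a) u∈row
...     | b , b∈t , refl = a , b , a∈s , b∈t , refl

inter-⊆ˡ : ∀ a b → inter a b ⊆ a
inter-⊆ˡ a b = proj₁ ∘′ ∈-keep⁻ (b ∋ᵇ_) {a}

inter-⊆ʳ : ∀ a b → inter a b ⊆ b
inter-⊆ʳ a b n∈ = ∈ᵇ⇒∈ b _ (proj₂ (∈-keep⁻ (b ∋ᵇ_) {a} n∈))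

Valid-compose : ∀ {s t} → Valid s → Valid t → Valid (compose s t)
Valid-compose {s} {t} vs vt = record
  { entries  = entries
  ; disjoint = AllPairs.filter⁺ (λ s → T? (nonEmpty s)) (AllPairs.concat⁺ (All.tabulate row-disjoint) rows-disjoint)
  }
  where
  row : FinSet → Word
  row a = map (inter a) t
  entries : ∀ {u} → u ∈ compose s t → ValidEntry u
  entries u∈ with ∈-keep⁻ nonEmpty u∈
  ... | u∈′ , ne with ∈-intersections⁻ s t u∈′
  ...   | a , b , a∈s , _ , refl = ValidEntry-keep (b ∋ᵇ_) a (Valid.entries vs a∈s) ne
  row-disjoint : ∀ {r} → r ∈ map row s → AllPairs Disjoint r
  row-disjoint r∈ with ∈-map⁻ row r∈
  ... | a , _ , refl = AllPairs.map⁺ (AllPairs.map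
        (λ {b} {b′} → Disjoint-mono (inter-⊆ʳ a b) (inter-⊆ʳ a b′)) (Valid.disjoint vt))
  rows-disjoint : AllPairs (λ r r′ → All (λ u → All (Disjoint u) r′) r) (map row s)
  rows-disjoint = AllPairs.map⁺ (AllPairs.map across (Valid.disjoint vs))
    where
    across : ∀ {a a′} → Disjoint a a′ → All (λ u → All (Disjoint u) (row a′)) (row a)
    across {a} {a′} a#a′ = All.tabulate λ u∈ → All.tabulate λ u′∈ → entries-disjoint u∈ u′∈
      where
      entries-disjoint : ∀ {u u′} → u ∈ row a → u′ ∈ row a′ → Disjoint u u′
      entries-disjoint u∈ u′∈ with ∈-map⁻ (inter a) u∈ | ∈-map⁻ (inter a′) u′∈
      ... | b , _ , refl | b′ , _ , refl = Disjoint-mono (inter-⊆ˡ a b) (inter-⊆ˡ a′ b′) a#a′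

-- Subsets and splittings

subsets : List A → List (List A)
subsets []       = [] ∷ []
subsets (x ∷ xs) = map (x ∷_) (subsets xs) ++ subsets xs

subsets-⊆ : ∀ (xs : List A) {C} → C ∈ subsets xs → C ⊆ xs
subsets-⊆ []       (here refl) ()
subsets-⊆ (x ∷ xs) C∈ n∈C with ∈-++⁻ (map (x ∷_) (subsets xs)) C∈
... | inj₂ C∈′ = there (subsets-⊆ xs C∈′ n∈C)
... | inj₁ C∈′ with ∈-map⁻ (x ∷_) C∈′ | n∈C
...   | _ , _    , refl | here refl = here refl
...   | _ , C′∈ , refl | there n∈C′ = there (subsets-⊆ xs C′∈ n∈C′)

splitSet : FinSet → FinSet → FinSet × FinSet
splitSet C S = keep (C ∋ᵇ_) S , keep (not ∘′ (C ∋ᵇ_)) S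

splitEntries : FinSet → Word → Word × Word
splitEntries C w = map (keep (C ∋ᵇ_)) w , map (keep (not ∘′ (C ∋ᵇ_))) w

split : FinSet → Word → Word × Word
split C w = restrict (C ∋ᵇ_) w , restrict (not ∘′ (C ∋ᵇ_)) w

splitSet-cong : ∀ C D S → (∀ {n} → n ∈ S → C ∋ᵇ n ≡ D ∋ᵇ n) → splitSet C S ≡ splitSet D S
splitSet-cong C D S C≗D = cong₂ _,_ (keep-cong _ _ S C≗D) (keep-cong _ _ S (cong not ∘′ C≗D))

splitEntries-cong : ∀ C D w → (∀ {n} → n ∈ deg w → C ∋ᵇ n ≡ D ∋ᵇ n) → splitEntries C w ≡ splitEntries D w
splitEntries-cong C D w C≗D = cong₂ _,_ (map-keep-cong _ _ w C≗D) (map-keep-cong _ _ w (cong not ∘′ C≗D))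

split-cong : ∀ C D w → (∀ {n} → n ∈ deg w → C ∋ᵇ n ≡ D ∋ᵇ n) → split C w ≡ split D w
split-cong C D w C≗D = cong (λ (u , v) → dropEmpty u , dropEmpty v) (splitEntries-cong C D w C≗D)

agreeOn : List ℕ → (ℕ → Bool) → (ℕ → Bool) → Bool
agreeOn Y p q = all (λ y → does (p y ≟ᵇ q y)) Y

agreeOn⇒ : ∀ Y p q → agreeOn Y p q ≡ true → ∀ {y} → y ∈ Y → p y ≡ q y
agreeOn⇒ Y p q e = All.lookup (all⇒All _ (λ y → does⇒ (p y ≟ᵇ q y)) Y e)

⇒agreeOn : ∀ Y p q → (∀ {y} → y ∈ Y → p y ≡ q y) → agreeOn Y p q ≡ true
⇒agreeOn Y p q p≗q = All⇒all _ (λ {y} → dec-true (p y ≟ᵇ q y)) (All.tabulate p≗q)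

mulW-disjoint : ∀ u v → disjointᵇ (deg u) (deg v) ≡ true → mulW u v ≡ just (u ++ v)
mulW-disjoint u v = cong (if_then just (u ++ v) else nothing)

compW-same : ∀ u v → sameSet (deg u) (deg v) ≡ true → compW u v ≡ just (compose u v)
compW-same u v = cong (if_then just (compose u v) else nothing)

Op₂ : Set
Op₂ = Word → Word → Word → Word → Maybe Word × Maybe Word

apply₂ : Op₂ → Word × Word → Word × Word → Maybe Word × Maybe Word
apply₂ op₂ (u₁ , u₂) (v₁ , v₂) = op₂ u₁ u₂ v₁ v₂

justs : Word × Word → Maybe Word × Maybe Word
justs (u₁ , u₂) = just u₁ , just u₂

_++²_ : Word × Word → Word × Word → Word × Word
(u₁ , u₂) ++² (v₁ , v₂) = u₁ ++ v₁ , u₂ ++ v₂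

degs : Word × Word → FinSet
degs (u₁ , u₂) = deg u₁ ++ deg u₂

∈-deg-split₁ : ∀ C w {n} → n ∈ deg (proj₁ (split C w)) → n ∈ deg w
∈-deg-split₁ C w = proj₁ ∘′ ∈-deg-restrict⁻ (C ∋ᵇ_) w

∈-deg-split₂ : ∀ C w {n} → n ∈ deg (proj₂ (split C w)) → n ∈ deg w
∈-deg-split₂ C w = proj₁ ∘′ ∈-deg-restrict⁻ (not ∘′ (C ∋ᵇ_)) w

deg-split-cover : ∀ C w {n} → n ∈ deg w → n ∈ deg (proj₁ (split C w)) ⊎ n ∈ deg (proj₂ (split C w))
deg-split-cover C w {n} n∈w with C ∋ᵇ n in Cn
... | true  = inj₁ (∈-deg-restrict⁺ (C ∋ᵇ_) w n∈w Cn)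
... | false = inj₂ (∈-deg-restrict⁺ (not ∘′ (C ∋ᵇ_)) w n∈w (cong not Cn))

degs-split-⊆ : ∀ C w → degs (split C w) ⊆ deg w
degs-split-⊆ C w = [ ∈-deg-split₁ C w , ∈-deg-split₂ C w ]′ ∘′ ∈-++⁻ (deg (proj₁ (split C w)))

degs-split-⊇ : ∀ C w → deg w ⊆ degs (split C w)
degs-split-⊇ C w = [ ∈-++⁺ˡ , ∈-++⁺ʳ (deg (proj₁ (split C w))) ]′ ∘′ deg-split-cover C w

split-++ : ∀ {C D} s t → Disjoint (deg s) (deg t) → C ⊆ deg s → D ⊆ deg t →
           split (C ++ D) (s ++ t) ≡ split C s ++² split D t
split-++ {C} {D} s t s#t C⊆s D⊆t = cong₂ _,_ (on-pieces in-s in-t) (on-pieces (cong not ∘′ in-s) (cong not ∘′ in-t))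
  where
  in-s : ∀ {n} → n ∈ deg s → (C ++ D) ∋ᵇ n ≡ C ∋ᵇ n
  in-s n∈s = ∋ᵇ-++ˡ C D (λ n∈D → s#t (n∈s , D⊆t n∈D))
  in-t : ∀ {n} → n ∈ deg t → (C ++ D) ∋ᵇ n ≡ D ∋ᵇ n
  in-t n∈t = ∋ᵇ-++ʳ C D (λ n∈C → s#t (C⊆s n∈C , n∈t))
  on-pieces : ∀ {p q r} → (∀ {n} → n ∈ deg s → p n ≡ q n) → (∀ {n} → n ∈ deg t → p n ≡ r n) →
              restrict p (s ++ t) ≡ restrict q s ++ restrict r t
  on-pieces p≗q p≗r = trans (restrict-++ _ s t) (cong₂ _++_ (restrict-cong _ _ s p≗q) (restrict-cong _ _ t p≗r))

sameSet-deg-restrict : ∀ p s t → deg s ⊆ deg t → deg t ⊆ deg s →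
                       sameSet (deg (restrict p s)) (deg (restrict p t)) ≡ true
sameSet-deg-restrict p s t s⊆t t⊆s = ⊆⊇⇒sameSet _ _ (transfer s t s⊆t) (transfer t s t⊆s)
  where
  transfer : ∀ u v → deg u ⊆ deg v → deg (restrict p u) ⊆ deg (restrict p v)
  transfer u v u⊆v n∈ = let n∈u , pn = ∈-deg-restrict⁻ p u n∈ in ∈-deg-restrict⁺ p v (u⊆v n∈u) pn

deg-compose-⊆ : ∀ s t → deg (compose s t) ⊆ deg s
deg-compose-⊆ s t n∈ with ∈-concat⁻′ (compose s t) n∈
... | u , n∈u , u∈ with ∈-intersections⁻ s t (proj₁ (∈-keep⁻ nonEmpty u∈))
...   | a , b , a∈s , _ , refl = ∈-concat⁺′ (inter-⊆ˡ a b n∈u) a∈s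

deg-compose-⊇ : ∀ s t → deg s ⊆ deg t → deg s ⊆ deg (compose s t)
deg-compose-⊇ s t s⊆t n∈s with ∈-concat⁻′ s n∈s | ∈-concat⁻′ t (s⊆t n∈s)
... | a , n∈a , a∈s | b , n∈b , b∈t = ∈-concat⁺′ n∈ab (∈-keep⁺ nonEmpty ab∈ (nonEmpty-∈ n∈ab))
  where
  n∈ab : _ ∈ inter a b
  n∈ab = ∈-keep⁺ (b ∋ᵇ_) n∈a (∈⇒∈ᵇ n∈b)
  ab∈ : inter a b ∈ intersections s t
  ab∈ = ∈-concat⁺′ (∈-map⁺ (inter a) b∈t) (∈-map⁺ (λ a → map (inter a) t) a∈s)
  nonEmpty-∈ : ∀ {n S} → n ∈ S → nonEmpty S ≡ true
  nonEmpty-∈ (here _)  = refl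
  nonEmpty-∈ (there _) = refl

sameSet-split₁⇒agreeOn : ∀ C D s t → deg t ⊆ deg s →
                         sameSet (deg (proj₁ (split C s))) (deg (proj₁ (split D t))) ≡ true →
                         agreeOn (deg t) (D ∋ᵇ_) (C ∋ᵇ_) ≡ true
sameSet-split₁⇒agreeOn C D s t t⊆s same = ⇒agreeOn (deg t) (D ∋ᵇ_) (C ∋ᵇ_) λ {n} n∈t → ≡true-ext
  (λ Dn → proj₂ (∈-deg-restrict⁻ (C ∋ᵇ_) s (Cs⊇Dt (∈-deg-restrict⁺ (D ∋ᵇ_) t n∈t Dn))))
  (λ Cn → proj₂ (∈-deg-restrict⁻ (D ∋ᵇ_) t (Cs⊆Dt (∈-deg-restrict⁺ (C ∋ᵇ_) s (t⊆s n∈t) Cn))))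
  where
  Cs⊆Dt = proj₁ (sameSet⇒⊆⊇ _ _ same)
  Cs⊇Dt = proj₂ (sameSet⇒⊆⊇ _ _ same)

sameSet-splits⇒sameSet : ∀ C D s t →
                         sameSet (deg (proj₁ (split C s))) (deg (proj₁ (split D t))) ≡ true →
                         sameSet (deg (proj₂ (split C s))) (deg (proj₂ (split D t))) ≡ true →
                         sameSet (deg s) (deg t) ≡ true
sameSet-splits⇒sameSet C D s t same₁ same₂ = ⊆⊇⇒sameSet (deg s) (deg t)
  (λ n∈s → [ ∈-deg-split₁ D t ∘′ proj₁ S₁ , ∈-deg-split₂ D t ∘′ proj₁ S₂ ]′ (deg-split-cover C s n∈s))
  (λ n∈t → [ ∈-deg-split₁ C s ∘′ proj₂ S₁ , ∈-deg-split₂ C s ∘′ proj₂ S₂ ]′ (deg-split-cover D t n∈t))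
  where
  S₁ = sameSet⇒⊆⊇ _ _ same₁
  S₂ = sameSet⇒⊆⊇ _ _ same₂

-- Finite sums over subsets

module FiniteSums {c ℓ} (M : CommutativeMonoid c ℓ) where

  open CommutativeMonoid M
    using (Carrier; _≈_; _∙_; ε; setoid; assoc; identityˡ; identityʳ; ∙-cong; ∙-congˡ; commutativeSemigroup)
    renaming (refl to ≈-refl; sym to ≈-sym; trans to ≈-trans; reflexive to ≡⇒≈)
  open import Algebra.Properties.CommutativeSemigroup commutativeSemigroup using (interchange)
  open import Relation.Binary.Reasoning.Setoid setoid

  ∑ : ∀ {a} {X : Set a} → List X → (X → Carrier) → Carrier
  ∑ []       f = ε
  ∑ (x ∷ xs) f = f x ∙ ∑ xs f

  syntax ∑ xs (λ x → e) = ∑[ x ∈ xs ] e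

  private
    variable
      a b : Level
      X : Set a
      Y : Set b

  ∑-++ : ∀ (xs ys : List X) f → ∑ (xs ++ ys) f ≈ ∑ xs f ∙ ∑ ys f
  ∑-++ []       ys f = ≈-sym (identityˡ _)
  ∑-++ (x ∷ xs) ys f = ≈-trans (∙-congˡ (∑-++ xs ys f)) (≈-sym (assoc _ _ _))

  ∑-concatMap : ∀ (g : X → List Y) xs f → ∑ (concatMap g xs) f ≈ ∑[ x ∈ xs ] ∑ (g x) f
  ∑-concatMap g []       f = ≈-refl
  ∑-concatMap g (x ∷ xs) f = ≈-trans (∑-++ (g x) (concatMap g xs) f) (∙-congˡ (∑-concatMap g xs f))

  ∑-map : ∀ (g : X → Y) xs f → ∑ (map g xs) f ≡ ∑[ x ∈ xs ] f (g x)
  ∑-map g []       f = refl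
  ∑-map g (x ∷ xs) f = cong (f (g x) ∙_) (∑-map g xs f)

  ∑-cong : ∀ (xs : List X) {f g} → (∀ {x} → x ∈ xs → f x ≈ g x) → ∑ xs f ≈ ∑ xs g
  ∑-cong []       _   = ≈-refl
  ∑-cong (x ∷ xs) f≈g = ∙-cong (f≈g (here refl)) (∑-cong xs (f≈g ∘′ there))

  ∑-∙ : ∀ (xs : List X) f g → ∑[ x ∈ xs ] (f x ∙ g x) ≈ ∑ xs f ∙ ∑ xs g
  ∑-∙ []       f g = ≈-sym (identityˡ ε)
  ∑-∙ (x ∷ xs) f g = ≈-trans (∙-congˡ (∑-∙ xs f g)) (interchange _ _ _ _)

  ∑-ε : ∀ (xs : List X) → ∑[ _ ∈ xs ] ε ≈ ε
  ∑-ε []       = ≈-refl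
  ∑-ε (x ∷ xs) = ≈-trans (identityˡ _) (∑-ε xs)

  ∑-zero : ∀ (xs : List X) {f} → (∀ {x} → x ∈ xs → f x ≈ ε) → ∑ xs f ≈ ε
  ∑-zero xs f≈ε = ≈-trans (∑-cong xs f≈ε) (∑-ε xs)

  ∑-swap : ∀ xs ys (f : X → Y → Carrier) → ∑[ x ∈ xs ] ∑[ y ∈ ys ] f x y ≈ ∑[ y ∈ ys ] ∑[ x ∈ xs ] f x y
  ∑-swap []       ys f = ≈-sym (∑-ε ys)
  ∑-swap (x ∷ xs) ys f = begin
    ∑ ys (f x) ∙ ∑[ x′ ∈ xs ] ∑ ys (f x′)       ≈⟨ ∙-congˡ (∑-swap xs ys f) ⟩
    ∑ ys (f x) ∙ ∑[ y ∈ ys ] ∑[ x′ ∈ xs ] f x′ y ≈⟨ ∑-∙ ys (f x) _ ⟨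
    ∑[ y ∈ ys ] (f x y ∙ ∑[ x′ ∈ xs ] f x′ y)    ∎

  ∑-subsets-∷ : ∀ {A : Set} x (xs : List A) f → ∑ (subsets (x ∷ xs)) f ≈ ∑[ C ∈ subsets xs ] f (x ∷ C) ∙ ∑ (subsets xs) f
  ∑-subsets-∷ x xs f =
    ≈-trans (∑-++ (map (x ∷_) (subsets xs)) (subsets xs) f) (∙-cong (≡⇒≈ (∑-map (x ∷_) (subsets xs) f)) ≈-refl)

  ∑-subsets-++ : ∀ {A : Set} (xs ys : List A) f →
                 ∑ (subsets (xs ++ ys)) f ≈ ∑[ C ∈ subsets xs ] ∑[ D ∈ subsets ys ] f (C ++ D)
  ∑-subsets-++ []       ys f = ≈-sym (identityʳ _)
  ∑-subsets-++ {A} (x ∷ xs) ys f = begin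
    ∑ (subsets (x ∷ xs ++ ys)) f
      ≈⟨ ∑-subsets-∷ x (xs ++ ys) f ⟩
    ∑[ C ∈ subsets (xs ++ ys) ] f (x ∷ C) ∙ ∑ (subsets (xs ++ ys)) f
      ≈⟨ ∙-cong (∑-subsets-++ xs ys (f ∘′ (x ∷_))) (∑-subsets-++ xs ys f) ⟩
    ∑[ C ∈ subsets xs ] F (x ∷ C) ∙ ∑ (subsets xs) F
      ≈⟨ ∑-subsets-∷ x xs F ⟨
    ∑ (subsets (x ∷ xs)) F
      ∎
    where
    F : List A → Carrier
    F C = ∑[ D ∈ subsets ys ] f (C ++ D)

  ∑-splits : ∀ S → Unique S → (H : FinSet × FinSet → Carrier) →
             ∑ (splits S) H ≈ ∑[ C ∈ subsets S ] H (splitSet C S)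
  ∑-splits []       _         H = ≈-refl
  ∑-splits (x ∷ xs) u@(_ ∷ u′) H = begin
    ∑ (splits (x ∷ xs)) H
      ≈⟨ ∑-concatMap _ (splits xs) H ⟩
    ∑[ (l , r) ∈ splits xs ] (H (x ∷ l , r) ∙ (H (l , x ∷ r) ∙ ε))
      ≈⟨ ∑-splits xs u′ _ ⟩
    ∑[ C ∈ subsets xs ] (H (x ∷ keep (C ∋ᵇ_) xs , keep (not ∘′ (C ∋ᵇ_)) xs) ∙
                         (H (keep (C ∋ᵇ_) xs , x ∷ keep (not ∘′ (C ∋ᵇ_)) xs) ∙ ε))
      ≈⟨ ∑-cong (subsets xs) (λ {C} C∈ →
           ∙-cong (≡⇒≈ (cong H (sym (splitSet-with-x C)))) (≈-trans (identityʳ _) (≡⇒≈ (cong H (sym (splitSet-without-x C∈)))))) ⟩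
    ∑[ C ∈ subsets xs ] (G (x ∷ C) ∙ G C)
      ≈⟨ ∑-∙ (subsets xs) (G ∘′ (x ∷_)) G ⟩
    ∑[ C ∈ subsets xs ] G (x ∷ C) ∙ ∑ (subsets xs) G
      ≈⟨ ∑-subsets-∷ x xs G ⟨
    ∑ (subsets (x ∷ xs)) G
      ∎
    where
    G : FinSet → Carrier
    G C = H (splitSet C (x ∷ xs))
    x∉xs = Unique-head u
    ≢x : ∀ {n} → n ∈ xs → n ≢ x
    ≢x n∈xs refl = x∉xs n∈xs
    splitSet-with-x : ∀ C → splitSet (x ∷ C) (x ∷ xs) ≡ (x ∷ keep (C ∋ᵇ_) xs , keep (not ∘′ (C ∋ᵇ_)) xs)
    splitSet-with-x C = cong₂ _,_
      (trans (keep-accept _ x xs (∋ᵇ-head x C)) (cong (x ∷_) (keep-cong _ _ xs (∋ᵇ-tail x C ∘′ ≢x))))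
      (trans (keep-reject _ x xs (cong not (∋ᵇ-head x C))) (keep-cong _ _ xs (cong not ∘′ ∋ᵇ-tail x C ∘′ ≢x)))
    splitSet-without-x : ∀ {C} → C ∈ subsets xs → splitSet C (x ∷ xs) ≡ (keep (C ∋ᵇ_) xs , x ∷ keep (not ∘′ (C ∋ᵇ_)) xs)
    splitSet-without-x {C} C∈ = cong₂ _,_ (keep-reject _ x xs x∉C) (keep-accept _ x xs (cong not x∉C))
      where
      x∉C = ∉⇒∈ᵇ≡false C (x∉xs ∘′ subsets-⊆ xs C∈)

  ∑-splitsW : ∀ w → Unique (deg w) → (G : Word × Word → Carrier) →
              ∑ (splitsW w) G ≈ ∑[ C ∈ subsets (deg w) ] G (splitEntries C w)
  ∑-splitsW []      _ G = ≈-refl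
  ∑-splitsW (S ∷ w) u G = begin
    ∑ (splitsW (S ∷ w)) G
      ≈⟨ ∑-concatMap _ (splits S) G ⟩
    ∑[ p ∈ splits S ] ∑ (map (cons p) (splitsW w)) G
      ≈⟨ ∑-cong (splits S) (λ {p} _ → ≈-trans (≡⇒≈ (∑-map (cons p) (splitsW w) G)) (∑-splitsW w uw (G ∘′ cons p))) ⟩
    ∑[ p ∈ splits S ] ∑[ D ∈ subsets (deg w) ] G (cons p (splitEntries D w))
      ≈⟨ ∑-splits S uS _ ⟩
    ∑[ C ∈ subsets S ] ∑[ D ∈ subsets (deg w) ] G (cons (splitSet C S) (splitEntries D w))
      ≈⟨ ∑-cong (subsets S) (λ C∈ → ∑-cong (subsets (deg w)) (λ D∈ → ≡⇒≈ (cong G (sym (splitEntries-++ C∈ D∈))))) ⟩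
    ∑[ C ∈ subsets S ] ∑[ D ∈ subsets (deg w) ] G (splitEntries (C ++ D) (S ∷ w))
      ≈⟨ ∑-subsets-++ S (deg w) _ ⟨
    ∑[ C ∈ subsets (S ++ deg w) ] G (splitEntries C (S ∷ w))
      ∎
    where
    cons : FinSet × FinSet → Word × Word → Word × Word
    cons (l , r) (ls , rs) = l ∷ ls , r ∷ rs
    uS,uw,S#w = Unique-++⁻ S u
    uS = proj₁ uS,uw,S#w
    uw = proj₁ (proj₂ uS,uw,S#w)
    S#w = proj₂ (proj₂ uS,uw,S#w)
    splitEntries-++ : ∀ {C D} → C ∈ subsets S → D ∈ subsets (deg w) →
                      splitEntries (C ++ D) (S ∷ w) ≡ cons (splitSet C S) (splitEntries D w)
    splitEntries-++ {C} {D} C∈ D∈ = cong₂ cons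
      (splitSet-cong (C ++ D) C S (λ n∈S → ∋ᵇ-++ˡ C D (λ n∈D → S#w (n∈S , subsets-⊆ (deg w) D∈ n∈D))))
      (splitEntries-cong (C ++ D) D w (λ n∈w → ∋ᵇ-++ʳ C D (λ n∈C → S#w (subsets-⊆ S C∈ n∈C , n∈w))))

  ∑-deltaW : ∀ w → Unique (deg w) → (F : Word × Word → Carrier) →
             ∑ (deltaW w) F ≈ ∑[ C ∈ subsets (deg w) ] F (split C w)
  ∑-deltaW w u F = ≈-trans (≡⇒≈ (∑-map _ (splitsW w) F)) (∑-splitsW w u _)

  ∑-subsets-agreeing : ∀ Y → Unique Y → (φ : ℕ → Bool) (g : Carrier) →
                       ∑[ B ∈ subsets Y ] (if agreeOn Y (B ∋ᵇ_) φ then g else ε) ≈ g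
  ∑-subsets-agreeing []      _         φ g = identityʳ g
  ∑-subsets-agreeing (y ∷ Y) u@(_ ∷ u′) φ g = begin
    ∑ (subsets (y ∷ Y)) term
      ≈⟨ ∑-subsets-∷ y Y term ⟩
    ∑[ B ∈ subsets Y ] term (y ∷ B) ∙ ∑ (subsets Y) term
      ≈⟨ ∙-cong (∑-cong (subsets Y) (≡⇒≈ ∘′ cong (λ b → if b then g else ε) ∘′ agree-with-y))
                (∑-cong (subsets Y) (≡⇒≈ ∘′ cong (λ b → if b then g else ε) ∘′ agree-without-y)) ⟩
    ∑[ B ∈ subsets Y ] (if does (true ≟ᵇ φ y) ∧ agreeOn Y (B ∋ᵇ_) φ then g else ε) ∙
    ∑[ B ∈ subsets Y ] (if does (false ≟ᵇ φ y) ∧ agreeOn Y (B ∋ᵇ_) φ then g else ε)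
      ≈⟨ exactly-one (φ y) ⟩
    g ∎
    where
    term : FinSet → Carrier
    term B = if agreeOn (y ∷ Y) (B ∋ᵇ_) φ then g else ε
    ≢y : ∀ {n} → n ∈ Y → n ≢ y
    ≢y n∈Y refl = Unique-head u n∈Y
    agree-with-y : ∀ {B} → B ∈ subsets Y → agreeOn (y ∷ Y) ((y ∷ B) ∋ᵇ_) φ ≡ (does (true ≟ᵇ φ y) ∧ agreeOn Y (B ∋ᵇ_) φ)
    agree-with-y {B} _ = cong₂ (λ b r → does (b ≟ᵇ φ y) ∧ r) (∋ᵇ-head y B)
      (all-cong _ _ Y (λ {n} n∈Y → cong (λ b → does (b ≟ᵇ φ n)) (∋ᵇ-tail y B (≢y n∈Y))))
    agree-without-y : ∀ {B} → B ∈ subsets Y → agreeOn (y ∷ Y) (B ∋ᵇ_) φ ≡ (does (false ≟ᵇ φ y) ∧ agreeOn Y (B ∋ᵇ_) φ)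
    agree-without-y {B} B∈ = cong (λ b → does (b ≟ᵇ φ y) ∧ agreeOn Y (B ∋ᵇ_) φ)
      (∉⇒∈ᵇ≡false B (Unique-head u ∘′ subsets-⊆ Y B∈))
    exactly-one : ∀ b → ∑[ B ∈ subsets Y ] (if does (true ≟ᵇ b) ∧ agreeOn Y (B ∋ᵇ_) φ then g else ε) ∙
                        ∑[ B ∈ subsets Y ] (if does (false ≟ᵇ b) ∧ agreeOn Y (B ∋ᵇ_) φ then g else ε) ≈ g
    exactly-one true  = ≈-trans (∙-cong (∑-subsets-agreeing Y u′ φ g) (∑-ε (subsets Y))) (identityʳ g)
    exactly-one false = ≈-trans (∙-cong (∑-ε (subsets Y)) (∑-subsets-agreeing Y u′ φ g)) (identityˡ g)

  -- Both sides equal the sum over the pairs (C , A) that agree on W, which is X as a set.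
  ∑-subsets-reindex : ∀ {W X} → Unique W → Unique X → W ⊆ X → X ⊆ W → (g : FinSet → Carrier) →
                      (∀ {C A} → (∀ {n} → n ∈ W → C ∋ᵇ n ≡ A ∋ᵇ n) → g C ≈ g A) →
                      ∑ (subsets W) g ≈ ∑ (subsets X) g
  ∑-subsets-reindex {W} {X} uW uX W⊆X X⊆W g g-resp = ≈-sym (begin
    ∑ (subsets X) g
      ≈⟨ ∑-cong (subsets X) (λ {A} _ → ≈-sym (∑-subsets-agreeing W uW (A ∋ᵇ_) (g A))) ⟩
    ∑[ A ∈ subsets X ] ∑[ C ∈ subsets W ] (if agreeOn W (C ∋ᵇ_) (A ∋ᵇ_) then g A else ε)
      ≈⟨ ∑-cong (subsets X) (λ {A} _ → ∑-cong (subsets W) (λ {C} _ → move C A)) ⟩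
    ∑[ A ∈ subsets X ] ∑[ C ∈ subsets W ] (if agreeOn W (C ∋ᵇ_) (A ∋ᵇ_) then g C else ε)
      ≈⟨ ∑-swap (subsets X) (subsets W) _ ⟩
    ∑[ C ∈ subsets W ] ∑[ A ∈ subsets X ] (if agreeOn W (C ∋ᵇ_) (A ∋ᵇ_) then g C else ε)
      ≈⟨ ∑-cong (subsets W) (λ {C} _ → ∑-cong (subsets X) (λ {A} _ →
           ≡⇒≈ (cong (λ b → if b then g C else ε) (agreeOn-swap C A)))) ⟩
    ∑[ C ∈ subsets W ] ∑[ A ∈ subsets X ] (if agreeOn X (A ∋ᵇ_) (C ∋ᵇ_) then g C else ε)
      ≈⟨ ∑-cong (subsets W) (λ {C} _ → ∑-subsets-agreeing X uX (C ∋ᵇ_) (g C)) ⟩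
    ∑ (subsets W) g ∎)
    where
    move : ∀ C A → (if agreeOn W (C ∋ᵇ_) (A ∋ᵇ_) then g A else ε) ≈ (if agreeOn W (C ∋ᵇ_) (A ∋ᵇ_) then g C else ε)
    move C A with agreeOn W (C ∋ᵇ_) (A ∋ᵇ_) in e
    ... | true  = ≈-sym (g-resp (agreeOn⇒ W (C ∋ᵇ_) (A ∋ᵇ_) e))
    ... | false = ≈-refl
    agreeOn-swap : ∀ C A → agreeOn W (C ∋ᵇ_) (A ∋ᵇ_) ≡ agreeOn X (A ∋ᵇ_) (C ∋ᵇ_)
    agreeOn-swap C A = ≡true-ext
      (λ e → ⇒agreeOn X (A ∋ᵇ_) (C ∋ᵇ_) (λ n∈X → sym (agreeOn⇒ W (C ∋ᵇ_) (A ∋ᵇ_) e (X⊆W n∈X))))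
      (λ e → ⇒agreeOn W (C ∋ᵇ_) (A ∋ᵇ_) (λ n∈W → sym (agreeOn⇒ X (A ∋ᵇ_) (C ∋ᵇ_) e (W⊆X n∈W))))

module PairProducts {c ℓ} (k : Field c ℓ) where

  open Tensor k

  mul₂W-disjoint : ∀ u v → Disjoint (degs u) (degs v) → apply₂ mul₂W u v ≡ justs (u ++² v)
  mul₂W-disjoint (u₁ , u₂) (v₁ , v₂) u#v =
    trans (cong (if_then (mulW u₁ v₁ , mulW u₂ v₂) else (nothing , nothing)) (Disjoint⇒disjointᵇ _ _ u#v))
          (cong₂ _,_ (mulW-disjoint u₁ v₁ (Disjoint⇒disjointᵇ (deg u₁) (deg v₁) (Disjoint-mono ∈-++⁺ˡ ∈-++⁺ˡ u#v)))
                     (mulW-disjoint u₂ v₂ (Disjoint⇒disjointᵇ (deg u₂) (deg v₂)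
                       (Disjoint-mono (∈-++⁺ʳ (deg u₁)) (∈-++⁺ʳ (deg v₁)) u#v))))

  mul₂W-overlap : ∀ u v → disjointᵇ (degs u) (degs v) ≡ false → apply₂ mul₂W u v ≡ (nothing , nothing)
  mul₂W-overlap (u₁ , u₂) (v₁ , v₂) = cong (if_then (mulW u₁ v₁ , mulW u₂ v₂) else (nothing , nothing))

  comp₂W-split : ∀ C s t → deg s ⊆ deg t → deg t ⊆ deg s →
                 apply₂ comp₂W (split C s) (split C t) ≡ justs (split C (compose s t))
  comp₂W-split C s t s⊆t t⊆s = cong₂ _,_ (same (C ∋ᵇ_)) (same (not ∘′ (C ∋ᵇ_)))
    where
    same : ∀ p → compW (restrict p s) (restrict p t) ≡ just (restrict p (compose s t))
    same p = trans (compW-same (restrict p s) (restrict p t) (sameSet-deg-restrict p s t s⊆t t⊆s))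
                   (cong just (sym (restrict-compose p s t)))

-- Coefficients of a fixed basis tensor b₁ ⊗ b₂

module Coefficients {c ℓ} (k : Field c ℓ) (b₁ b₂ : Basis) where

  open Field k using (Carrier; _≈_; _+_; _*_; 0#; setoid; +-commutativeMonoid; +-identityʳ)
    renaming (refl to ≈-refl; sym to ≈-sym; trans to ≈-trans; reflexive to ≡⇒≈)
  open Tensor k
  open FiniteSums +-commutativeMonoid
  open PairProducts k
  open import Relation.Binary.Reasoning.Setoid setoid

  coeff₂ᵂ : Carrier → Word × Word → Carrier
  coeff₂ᵂ a (u , v) = if eqW u (proj₁ b₁) ∧ eqW v (proj₁ b₂) then a else 0#

  coeff₂ᴹ : Carrier → Maybe Word × Maybe Word → Carrier
  coeff₂ᴹ a (just u , just v) = coeff₂ᵂ a (u , v)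
  coeff₂ᴹ a (just _ , nothing) = 0#
  coeff₂ᴹ a (nothing , _)      = 0#

  words : Carrier × Basis × Basis → Word × Word
  words (_ , (u , _) , (v , _)) = u , v

  term : Carrier × Basis × Basis → Carrier
  term e = coeff₂ᵂ (proj₁ e) (words e)

  coeff₂≡∑ : ∀ L → coeff₂ L b₁ b₂ ≡ ∑ L term
  coeff₂≡∑ []      = refl
  coeff₂≡∑ (e ∷ L) = cong (term e +_) (coeff₂≡∑ L)

  eqW⇒≡ : ∀ u v → eqW u v ≡ true → u ≡ v
  eqW⇒≡ u v = does⇒ (≡-dec (≡-dec _≟_) u v)

  coeff₂ᵂ-invalid₁ : ∀ a u v → ¬ T (valid u) → coeff₂ᵂ a (u , v) ≡ 0#
  coeff₂ᵂ-invalid₁ a u v ¬vu with eqW u (proj₁ b₁) in e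
  ... | true  = ⊥-elim (¬vu (subst (T ∘′ valid) (sym (eqW⇒≡ u _ e)) (proj₂ b₁)))
  ... | false = refl

  coeff₂ᵂ-invalid₂ : ∀ a u v → ¬ T (valid v) → coeff₂ᵂ a (u , v) ≡ 0#
  coeff₂ᵂ-invalid₂ a u v ¬vv with eqW u (proj₁ b₁)
  ... | false = refl
  ... | true with eqW v (proj₁ b₂) in e
  ...   | true  = ⊥-elim (¬vv (subst (T ∘′ valid) (sym (eqW⇒≡ v _ e)) (proj₂ b₂)))
  ...   | false = refl

  toBasis-cases : ∀ w → (∃[ p ] toBasis w ≡ (w , p) ∷ []) ⊎ (¬ T (valid w) × toBasis w ≡ [])
  toBasis-cases w with T? (valid w)
  ... | yes p  = inj₁ (p , refl)
  ... | no ¬p = inj₂ (¬p , refl)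

  ∑-embed₂ : ∀ a u v → T (valid u) → T (valid v) → (H : Carrier → Word × Word → Carrier) →
             ∑[ e ∈ embed₂ a (just u) (just v) ] H (proj₁ e) (words e) ≈ H a (u , v)
  ∑-embed₂ a u v vu vv H with toBasis-cases u | toBasis-cases v
  ... | inj₁ (_ , eu) | inj₁ (_ , ev) rewrite eu | ev = +-identityʳ _
  ... | inj₂ (¬vu , _) | _             = ⊥-elim (¬vu vu)
  ... | inj₁ _         | inj₂ (¬vv , _) = ⊥-elim (¬vv vv)

  -- embed₂ drops invalid words, whose coefficient at the valid b₁ ⊗ b₂ is 0 anyway.
  coeff₂-embed₂ : ∀ a m → coeff₂ (embed₂ a (proj₁ m) (proj₂ m)) b₁ b₂ ≈ coeff₂ᴹ a m
  coeff₂-embed₂ a (just u , just v) with toBasis-cases u | toBasis-cases v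
  ... | inj₁ (_ , eu) | inj₁ (_ , ev)   rewrite eu | ev = +-identityʳ _
  ... | inj₂ (¬vu , eu) | _             rewrite eu = ≡⇒≈ (sym (coeff₂ᵂ-invalid₁ a u v ¬vu))
  ... | inj₁ (_ , eu) | inj₂ (¬vv , ev) rewrite eu | ev = ≡⇒≈ (sym (coeff₂ᵂ-invalid₂ a u v ¬vv))
  coeff₂-embed₂ a (just _ , nothing) = ≈-refl
  coeff₂-embed₂ a (nothing , _)      = ≈-refl

  δ-term : Carrier × Basis → 𝒯⊗𝒯
  δ-term p = concatMap (λ q → embed₂ (proj₁ p) (just (proj₁ q)) (just (proj₂ q))) (deltaW (proj₁ (proj₂ p)))

  ∑-δ-term : ∀ a w (vw : T (valid w)) (H : Carrier → Word × Word → Carrier) →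
             ∑[ e ∈ δ-term (a , w , vw) ] H (proj₁ e) (words e) ≈ ∑[ C ∈ subsets (deg w) ] H a (split C w)
  ∑-δ-term a w vw H = begin
    ∑[ e ∈ δ-term (a , w , vw) ] H (proj₁ e) (words e)
      ≈⟨ ∑-concatMap _ (deltaW w) _ ⟩
    ∑[ q ∈ deltaW w ] ∑[ e ∈ embed₂ a (just (proj₁ q)) (just (proj₂ q)) ] H (proj₁ e) (words e)
      ≈⟨ ∑-deltaW w (Valid⇒Unique-deg Vw) _ ⟩
    ∑[ C ∈ subsets (deg w) ] ∑[ e ∈ embed₂ a (just (proj₁ (split C w))) (just (proj₂ (split C w))) ]
      H (proj₁ e) (words e)
      ≈⟨ ∑-cong (subsets (deg w)) (λ {C} _ → ∑-embed₂ a _ _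
           (Valid⇒T-valid (Valid-restrict (C ∋ᵇ_) {w} Vw))
           (Valid⇒T-valid (Valid-restrict (not ∘′ (C ∋ᵇ_)) {w} Vw)) H) ⟩
    ∑[ C ∈ subsets (deg w) ] H a (split C w)
      ∎
    where
    Vw = T-valid⇒Valid {w} vw

  coeff₂-δ-embed : ∀ a w → T (valid w) →
                   coeff₂ (δ (embed a (just w))) b₁ b₂ ≈ ∑[ C ∈ subsets (deg w) ] coeff₂ᵂ a (split C w)
  coeff₂-δ-embed a w vw with toBasis-cases w
  ... | inj₂ (¬vw , _) = ⊥-elim (¬vw vw)
  ... | inj₁ (p , e) rewrite e = begin
    coeff₂ (δ-term (a , w , p) ++ []) b₁ b₂     ≡⟨ coeff₂≡∑ (δ-term (a , w , p) ++ []) ⟩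
    ∑ (δ-term (a , w , p) ++ []) term           ≈⟨ ∑-++ (δ-term (a , w , p)) [] term ⟩
    ∑ (δ-term (a , w , p)) term + 0#            ≈⟨ +-identityʳ _ ⟩
    ∑ (δ-term (a , w , p)) term                 ≈⟨ ∑-δ-term a w p coeff₂ᵂ ⟩
    ∑[ C ∈ subsets (deg w) ] coeff₂ᵂ a (split C w) ∎

  -- By ∑-δ-term, the right-hand side is the b₁ ⊗ b₂-coefficient of a · (δ 1_s ⋆ δ 1_t), ⋆ = op₂.
  BasisCompatible : (Word → Word → Maybe Word) → Op₂ → Set (c ⊔ ℓ)
  BasisCompatible op op₂ = ∀ a s t → T (valid s) → T (valid t) →
    coeff₂ (δ (embed a (op s t))) b₁ b₂ ≈
    ∑[ C ∈ subsets (deg s) ] ∑[ D ∈ subsets (deg t) ] coeff₂ᴹ a (apply₂ op₂ (split C s) (split D t))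

  module _ (op : Word → Word → Maybe Word) (op₂ : Op₂) where

    bilin-term : Carrier × Basis → Carrier × Basis → 𝒯
    bilin-term p q = embed (proj₁ p * proj₁ q) (op (proj₁ (proj₂ p)) (proj₁ (proj₂ q)))

    bilin₂-term : Carrier × Basis × Basis → Carrier × Basis × Basis → 𝒯⊗𝒯
    bilin₂-term P Q = embed₂ (proj₁ P * proj₁ Q) (proj₁ r) (proj₂ r)
      where
      r = apply₂ op₂ (words P) (words Q)

    coeff₂-δ-bilin : ∀ x y → coeff₂ (δ (bilin op x y)) b₁ b₂ ≈ ∑[ p ∈ x ] ∑[ q ∈ y ] ∑ (δ (bilin-term p q)) term
    coeff₂-δ-bilin x y = begin
      coeff₂ (δ (bilin op x y)) b₁ b₂
        ≡⟨ coeff₂≡∑ (δ (bilin op x y)) ⟩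
      ∑ (δ (bilin op x y)) term
        ≈⟨ ∑-concatMap δ-term (bilin op x y) term ⟩
      ∑[ e ∈ bilin op x y ] ∑ (δ-term e) term
        ≈⟨ ∑-concatMap (λ p → concatMap (bilin-term p) y) x _ ⟩
      ∑[ p ∈ x ] ∑[ e ∈ concatMap (bilin-term p) y ] ∑ (δ-term e) term
        ≈⟨ ∑-cong x (λ {p} _ → ∑-concatMap (bilin-term p) y _) ⟩
      ∑[ p ∈ x ] ∑[ q ∈ y ] ∑[ e ∈ bilin-term p q ] ∑ (δ-term e) term
        ≈⟨ ∑-cong x (λ {p} _ → ∑-cong y (λ {q} _ → ∑-concatMap δ-term (bilin-term p q) term)) ⟨
      ∑[ p ∈ x ] ∑[ q ∈ y ] ∑ (δ (bilin-term p q)) term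
        ∎

    coeff₂-bilin₂-δ : ∀ x y → coeff₂ (bilin₂ op₂ (δ x) (δ y)) b₁ b₂ ≈
                      ∑[ p ∈ x ] ∑[ q ∈ y ] ∑[ P ∈ δ-term p ] ∑[ Q ∈ δ-term q ] ∑ (bilin₂-term P Q) term
    coeff₂-bilin₂-δ x y = begin
      coeff₂ (bilin₂ op₂ (δ x) (δ y)) b₁ b₂
        ≡⟨ coeff₂≡∑ (bilin₂ op₂ (δ x) (δ y)) ⟩
      ∑ (bilin₂ op₂ (δ x) (δ y)) term
        ≈⟨ ∑-concatMap (λ P → concatMap (bilin₂-term P) (δ y)) (δ x) term ⟩
      ∑[ P ∈ δ x ] ∑ (concatMap (bilin₂-term P) (δ y)) term
        ≈⟨ ∑-concatMap δ-term x _ ⟩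
      ∑[ p ∈ x ] ∑[ P ∈ δ-term p ] ∑ (concatMap (bilin₂-term P) (δ y)) term
        ≈⟨ ∑-cong x (λ {p} _ → ∑-cong (δ-term p) (λ {P} _ →
             ≈-trans (∑-concatMap (bilin₂-term P) (δ y) term) (∑-concatMap δ-term y _))) ⟩
      ∑[ p ∈ x ] ∑[ P ∈ δ-term p ] ∑[ q ∈ y ] ∑[ Q ∈ δ-term q ] ∑ (bilin₂-term P Q) term
        ≈⟨ ∑-cong x (λ {p} _ → ∑-swap (δ-term p) y _) ⟩
      ∑[ p ∈ x ] ∑[ q ∈ y ] ∑[ P ∈ δ-term p ] ∑[ Q ∈ δ-term q ] ∑ (bilin₂-term P Q) term
        ∎

    bilin-compatible : BasisCompatible op op₂ →
                       ∀ x y → coeff₂ (δ (bilin op x y)) b₁ b₂ ≈ coeff₂ (bilin₂ op₂ (δ x) (δ y)) b₁ b₂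
    bilin-compatible compatible x y = begin
      coeff₂ (δ (bilin op x y)) b₁ b₂
        ≈⟨ coeff₂-δ-bilin x y ⟩
      ∑[ p ∈ x ] ∑[ q ∈ y ] ∑ (δ (bilin-term p q)) term
        ≈⟨ ∑-cong x (λ {p} _ → ∑-cong y (λ {q} _ → on-basis p q)) ⟩
      ∑[ p ∈ x ] ∑[ q ∈ y ] ∑[ P ∈ δ-term p ] ∑[ Q ∈ δ-term q ] ∑ (bilin₂-term P Q) term
        ≈⟨ coeff₂-bilin₂-δ x y ⟨
      coeff₂ (bilin₂ op₂ (δ x) (δ y)) b₁ b₂
        ∎
      where
      on-basis : ∀ p q → ∑ (δ (bilin-term p q)) term ≈ ∑[ P ∈ δ-term p ] ∑[ Q ∈ δ-term q ] ∑ (bilin₂-term P Q) term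
      on-basis (a , s , vs) (b , t , vt) = begin
        ∑ (δ (embed (a * b) (op s t))) term
          ≡⟨ coeff₂≡∑ (δ (embed (a * b) (op s t))) ⟨
        coeff₂ (δ (embed (a * b) (op s t))) b₁ b₂
          ≈⟨ compatible (a * b) s t vs vt ⟩
        ∑[ C ∈ subsets (deg s) ] ∑[ D ∈ subsets (deg t) ] coeff₂ᴹ (a * b) (apply₂ op₂ (split C s) (split D t))
          ≈⟨ ∑-δ-term a s vs (λ a′ u → ∑[ D ∈ subsets (deg t) ] coeff₂ᴹ (a′ * b) (apply₂ op₂ u (split D t))) ⟨
        ∑[ P ∈ δ-term (a , s , vs) ] ∑[ D ∈ subsets (deg t) ] coeff₂ᴹ (proj₁ P * b) (apply₂ op₂ (words P) (split D t))
          ≈⟨ ∑-cong (δ-term (a , s , vs)) (λ {P} _ →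
               ∑-δ-term b t vt (λ b′ v → coeff₂ᴹ (proj₁ P * b′) (apply₂ op₂ (words P) v))) ⟨
        ∑[ P ∈ δ-term (a , s , vs) ] ∑[ Q ∈ δ-term (b , t , vt) ]
          coeff₂ᴹ (proj₁ P * proj₁ Q) (apply₂ op₂ (words P) (words Q))
          ≈⟨ ∑-cong (δ-term (a , s , vs)) (λ {P} _ → ∑-cong (δ-term (b , t , vt)) (λ {Q} _ →
               ≈-trans (≈-sym (coeff₂-embed₂ _ (apply₂ op₂ (words P) (words Q))))
                       (≡⇒≈ (coeff₂≡∑ (bilin₂-term P Q))))) ⟩
        ∑[ P ∈ δ-term (a , s , vs) ] ∑[ Q ∈ δ-term (b , t , vt) ] ∑ (bilin₂-term P Q) term
          ∎

  mulW-compatible : BasisCompatible mulW mul₂W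
  -- Abstracting over disjointᵇ (deg s) (deg t) also evaluates mulW s t in the goal.
  mulW-compatible a s t vs vt with disjointᵇ (deg s) (deg t) in s#ᵇt
  ... | true = begin
    coeff₂ (δ (embed a (just (s ++ t)))) b₁ b₂
      ≈⟨ coeff₂-δ-embed a (s ++ t) (Valid⇒T-valid (Valid-++ (T-valid⇒Valid {s} vs) (T-valid⇒Valid {t} vt) s#t)) ⟩
    ∑[ C ∈ subsets (deg (s ++ t)) ] coeff₂ᵂ a (split C (s ++ t))
      ≡⟨ cong (λ X → ∑[ C ∈ subsets X ] coeff₂ᵂ a (split C (s ++ t))) (concat-++ s t) ⟨
    ∑[ C ∈ subsets (deg s ++ deg t) ] coeff₂ᵂ a (split C (s ++ t))
      ≈⟨ ∑-subsets-++ (deg s) (deg t) _ ⟩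
    ∑[ C ∈ subsets (deg s) ] ∑[ D ∈ subsets (deg t) ] coeff₂ᵂ a (split (C ++ D) (s ++ t))
      ≈⟨ ∑-cong (subsets (deg s)) (λ C∈ → ∑-cong (subsets (deg t)) (λ D∈ → ≡⇒≈ (on-pieces C∈ D∈))) ⟩
    ∑[ C ∈ subsets (deg s) ] ∑[ D ∈ subsets (deg t) ] coeff₂ᴹ a (apply₂ mul₂W (split C s) (split D t))
      ∎
    where
    s#t = disjointᵇ⇒Disjoint (deg s) (deg t) s#ᵇt
    on-pieces : ∀ {C D} → C ∈ subsets (deg s) → D ∈ subsets (deg t) →
                coeff₂ᵂ a (split (C ++ D) (s ++ t)) ≡ coeff₂ᴹ a (apply₂ mul₂W (split C s) (split D t))
    on-pieces {C} {D} C∈ D∈ = trans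
      (cong (coeff₂ᵂ a) (split-++ s t s#t (subsets-⊆ (deg s) C∈) (subsets-⊆ (deg t) D∈)))
      (sym (cong (coeff₂ᴹ a) (mul₂W-disjoint (split C s) (split D t)
        (Disjoint-mono (degs-split-⊆ C s) (degs-split-⊆ D t) s#t))))
  ... | false = begin
    coeff₂ (δ (embed a nothing)) b₁ b₂
      ≈⟨ ∑-zero (subsets (deg s)) (λ {C} _ → ∑-zero (subsets (deg t)) (λ {D} _ → ≡⇒≈ (on-pieces C D))) ⟨
    ∑[ C ∈ subsets (deg s) ] ∑[ D ∈ subsets (deg t) ] coeff₂ᴹ a (apply₂ mul₂W (split C s) (split D t))
      ∎
    where
    on-pieces : ∀ C D → coeff₂ᴹ a (apply₂ mul₂W (split C s) (split D t)) ≡ 0#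
    on-pieces C D = cong (coeff₂ᴹ a) (mul₂W-overlap (split C s) (split D t) (¬-not pieces-overlap))
      where
      pieces-overlap : disjointᵇ (degs (split C s)) (degs (split D t)) ≢ true
      pieces-overlap e = false≢true (trans (sym s#ᵇt) (Disjoint⇒disjointᵇ _ _
        (Disjoint-mono (degs-split-⊇ C s) (degs-split-⊇ D t) (disjointᵇ⇒Disjoint _ _ e))))

  coeff₂ᴹ-comp₂W-mismatch : ∀ a u v →
    (sameSet (deg (proj₁ u)) (deg (proj₁ v)) ≡ true → sameSet (deg (proj₂ u)) (deg (proj₂ v)) ≡ true → ⊥) →
    coeff₂ᴹ a (apply₂ comp₂W u v) ≡ 0#
  coeff₂ᴹ-comp₂W-mismatch a (u₁ , u₂) (v₁ , v₂) mismatch with sameSet (deg u₁) (deg v₁)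
  ... | false = refl
  ... | true with sameSet (deg u₂) (deg v₂)
  ...   | false = refl
  ...   | true  = ⊥-elim (mismatch refl refl)

  ∑-comp₂W-diagonal : ∀ a C s t → Unique (deg t) → deg s ⊆ deg t → deg t ⊆ deg s →
    ∑[ D ∈ subsets (deg t) ] coeff₂ᴹ a (apply₂ comp₂W (split C s) (split D t)) ≈ coeff₂ᵂ a (split C (compose s t))
  ∑-comp₂W-diagonal a C s t ut s⊆t t⊆s =
    ≈-trans (∑-cong (subsets (deg t)) (λ {D} _ → ≡⇒≈ (off-diagonal-vanishes D)))
            (∑-subsets-agreeing (deg t) ut (C ∋ᵇ_) (coeff₂ᵂ a (split C (compose s t))))
    where
    off-diagonal-vanishes : ∀ D → coeff₂ᴹ a (apply₂ comp₂W (split C s) (split D t)) ≡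
                                  (if agreeOn (deg t) (D ∋ᵇ_) (C ∋ᵇ_) then coeff₂ᵂ a (split C (compose s t)) else 0#)
    off-diagonal-vanishes D with agreeOn (deg t) (D ∋ᵇ_) (C ∋ᵇ_) in agree
    ... | true  = trans
      (cong (λ u → coeff₂ᴹ a (apply₂ comp₂W (split C s) u)) (split-cong D C t (agreeOn⇒ (deg t) (D ∋ᵇ_) (C ∋ᵇ_) agree)))
      (cong (coeff₂ᴹ a) (comp₂W-split C s t s⊆t t⊆s))
    ... | false = coeff₂ᴹ-comp₂W-mismatch a (split C s) (split D t)
                    (λ same₁ _ → false≢true (trans (sym agree) (sameSet-split₁⇒agreeOn C D s t t⊆s same₁)))

  compW-compatible : BasisCompatible compW comp₂W
  compW-compatible a s t vs vt with sameSet (deg s) (deg t) in s≈ᵇt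
  ... | true = begin
    coeff₂ (δ (embed a (just w))) b₁ b₂
      ≈⟨ coeff₂-δ-embed a w (Valid⇒T-valid Vw) ⟩
    ∑[ C ∈ subsets (deg w) ] g C
      ≈⟨ ∑-subsets-reindex (Valid⇒Unique-deg Vw) (Valid⇒Unique-deg Vs) (deg-compose-⊆ s t) (deg-compose-⊇ s t s⊆t) g
           (λ {C} {A} C≗A → ≡⇒≈ (cong (coeff₂ᵂ a) (split-cong C A w C≗A))) ⟩
    ∑[ C ∈ subsets (deg s) ] g C
      ≈⟨ ∑-cong (subsets (deg s)) (λ {C} _ → ≈-sym (∑-comp₂W-diagonal a C s t (Valid⇒Unique-deg Vt) s⊆t t⊆s)) ⟩
    ∑[ C ∈ subsets (deg s) ] ∑[ D ∈ subsets (deg t) ] coeff₂ᴹ a (apply₂ comp₂W (split C s) (split D t))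
      ∎
    where
    w = compose s t
    Vs = T-valid⇒Valid {s} vs
    Vt = T-valid⇒Valid {t} vt
    Vw = Valid-compose Vs Vt
    s⊆t = proj₁ (sameSet⇒⊆⊇ _ _ s≈ᵇt)
    t⊆s = proj₂ (sameSet⇒⊆⊇ _ _ s≈ᵇt)
    g : FinSet → Carrier
    g C = coeff₂ᵂ a (split C w)
  ... | false = begin
    coeff₂ (δ (embed a nothing)) b₁ b₂
      ≈⟨ ∑-zero (subsets (deg s)) (λ {C} _ → ∑-zero (subsets (deg t)) (λ {D} _ → ≡⇒≈ (on-pieces C D))) ⟨
    ∑[ C ∈ subsets (deg s) ] ∑[ D ∈ subsets (deg t) ] coeff₂ᴹ a (apply₂ comp₂W (split C s) (split D t))
      ∎
    where
    on-pieces : ∀ C D → coeff₂ᴹ a (apply₂ comp₂W (split C s) (split D t)) ≡ 0#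
    on-pieces C D = coeff₂ᴹ-comp₂W-mismatch a (split C s) (split D t)
      (λ same₁ same₂ → false≢true (trans (sym s≈ᵇt) (sameSet-splits⇒sameSet C D s t same₁ same₂)))

mainTheorem7 : ∀ {c ℓ} (k : Field c ℓ) → let open Tensor k in
    (∀ (x y : 𝒯) → δ (x ∗ y) ≋₂ (δ x ∗₂ δ y))
    × (∀ (x y : 𝒯) → δ (x ∘ y) ≋₂ (δ x ∘₂ δ y))
mainTheorem7 k = ∗-bialgebra , ∘-bialgebra
  where
  open Tensor k
  open Coefficients k using (bilin-compatible; mulW-compatible; compW-compatible)
  ∗-bialgebra : ∀ x y → δ (x ∗ y) ≋₂ (δ x ∗₂ δ y)
  ∗-bialgebra x y b₁ b₂ = bilin-compatible b₁ b₂ mulW mul₂W (mulW-compatible b₁ b₂) x y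
  ∘-bialgebra : ∀ x y → δ (x ∘ y) ≋₂ (δ x ∘₂ δ y)
  ∘-bialgebra x y b₁ b₂ = bilin-compatible b₁ b₂ compW comp₂W (compW-compatible b₁ b₂) x y
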